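{- Let $s\ge 0$ be an integer, let $\sigma\subseteq\{0,1,\dots,s\}$ and $\rho=\mathbb{N}\setminus\{0\}$. Let $G$ be a connected graph with type partition $V(G)=V_1\uplus\dots\uplus V_b$ (each $V_i$ consisting of vertices of the same type). If $D$ is a $[\sigma,\rho]$-dominating set of $G$, then for every $1\le i\le b$, either $|V_i\cap D|\le s+1$ or $|V_i\cap D|=|V_i|$.
   Context: $\mathbb{N}=\{0,1,2,\dots\}$. A set $D\subseteq V(G)$ is a $[\sigma,\rho]$-dominating set if every $v\in D$ has $|N(v)\cap D|\in\sigma$ and every $v\in V(G)\setminus D$ has $|N(v)\cap D|\in\rho$ ($N(v)$ the open neighborhood). Two vertices $u,v$ have the same type if $N(v)\setminus\{u\}=N(u)\setminus\{v\}$; a type partition is a partition of $V(G)$ into classes whose vertices all have the same type. -}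

module Defs where

open import Data.Nat using (ℕ; _≤_; _≥_)
open import Data.Bool using (Bool; true; false)
open import Data.Fin using (Fin)
open import Data.Fin.Subset using (Subset; _∈_; _∉_; _∩_; _-_; ∣_∣)
open import Data.Vec using (tabulate)
open import Data.Product using (_×_)
open import Relation.Binary.PropositionalEquality using (_≡_)
open import Relation.Nullary.Decidable using (⌊_⌋)
import Data.Fin as F

record Graph (n : ℕ) : Set where
  field
    adj   : Fin n → Fin n → Bool
    sym   : ∀ u v → adj u v ≡ adj v u
    irrefl : ∀ v → adj v v ≡ false
open Graph public

N : ∀ {n} → Graph n → Fin n → Subset n
N G v = tabulate (adj G v)

data Reach {n} (G : Graph n) : Fin n → Fin n → Set where
  here : ∀ {v} → Reach G v v
  step : ∀ {u v w} → adj G u v ≡ true → Reach G v w → Reach G u w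

Connected : ∀ {n} → Graph n → Set
Connected G = ∀ u v → Reach G u v

SameType : ∀ {n} → Graph n → Fin n → Fin n → Set
SameType G u v = N G v - u ≡ N G u - v

IsSigmaRhoDom : ∀ {n} → Graph n → (σ ρ : ℕ → Set) → Subset n → Set
IsSigmaRhoDom G σ ρ D =
  (∀ v → v ∈ D → σ ∣ N G v ∩ D ∣) × (∀ v → v ∉ D → ρ ∣ N G v ∩ D ∣)

Positive : ℕ → Set
Positive k = k ≥ 1

-- A type partition V(G) = V_1 ⊎ … ⊎ V_b given by a class-assignment c : Fin n → Fin b
-- such that any two vertices in the same class have the same type.
IsTypePartition : ∀ {n b} → Graph n → (Fin n → Fin b) → Set
IsTypePartition G c = ∀ u v → c u ≡ c v → SameType G u v

Class : ∀ {n b} → (Fin n → Fin b) → Fin b → Subset n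
Class c i = tabulate (λ v → ⌊ c v F.≟ i ⌋)

{-# OPTIONS --safe #-}
-- If some vertex x of a class V_i lies outside D, it has a neighbour y ∈ D. Every
-- other vertex z of V_i has the same type as x, so y ∈ N(x) ∖ {z} = N(z) ∖ {x}: y is
-- adjacent to all of (V_i ∩ D) ∖ {y}, whence |V_i ∩ D| ≤ |N(y) ∩ D| + 1 ≤ s + 1.
-- Otherwise V_i ⊆ D.
module Submission where

open import Defs
open import Data.Bool using (Bool; true)
open import Data.Bool.Properties using (T-≡)
open import Data.Empty using (⊥-elim)
open import Data.Fin using (Fin; _≟_)
open import Data.Fin.Properties using (any?)
open import Data.Fin.Subset
  using (Subset; inside; outside; _∈_; _∉_; _⊆_; _∩_; _─_; _-_; ⁅_⁆; ∣_∣; Nonempty)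
open import Data.Fin.Subset.Properties
open import Data.Nat using (ℕ; _≤_; _+_; z≤n; s≤s)
import Data.Nat.Properties as ℕ
open import Data.Product using (_×_; _,_; ∃)
open import Data.Sum using (_⊎_; inj₁; inj₂)
open import Data.Vec using (_∷_; []; here; there; tabulate)
open import Data.Vec.Properties using (lookup∘tabulate; []=⇒lookup; lookup⇒[]=)
open import Function.Bundles using (Equivalence)
open import Relation.Binary.PropositionalEquality as ≡ using (_≡_; _≢_; refl; cong; subst)
open import Relation.Nullary using (yes; no)
open import Relation.Nullary.Decidable using (⌊_⌋; toWitness; _×-dec_; ¬?)

private
  variable
    n : ℕ
    x : Fin n

x∈p─q⇒x∉q : ∀ (p q : Subset n) → x ∈ p ─ q → x ∉ q
x∈p─q⇒x∉q (inside ∷ p) (outside ∷ q) here ()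
x∈p─q⇒x∉q (_ ∷ p) (_ ∷ q) (there x∈p─q) (there x∈q) = x∈p─q⇒x∉q p q x∈p─q x∈q

∣p∣≤∣p─q∣+∣q∣ : ∀ (p q : Subset n) → ∣ p ∣ ≤ ∣ p ─ q ∣ + ∣ q ∣
∣p∣≤∣p─q∣+∣q∣ []            []            = z≤n
∣p∣≤∣p─q∣+∣q∣ (outside ∷ p) (outside ∷ q) = ∣p∣≤∣p─q∣+∣q∣ p q
∣p∣≤∣p─q∣+∣q∣ (outside ∷ p) (inside  ∷ q) =
  ℕ.≤-trans (∣p∣≤∣p─q∣+∣q∣ p q) (ℕ.+-monoʳ-≤ ∣ p ─ q ∣ (ℕ.n≤1+n ∣ q ∣))
∣p∣≤∣p─q∣+∣q∣ (inside  ∷ p) (outside ∷ q) = s≤s (∣p∣≤∣p─q∣+∣q∣ p q)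
∣p∣≤∣p─q∣+∣q∣ (inside  ∷ p) (inside  ∷ q) =
  ℕ.≤-trans (s≤s (∣p∣≤∣p─q∣+∣q∣ p q)) (ℕ.≤-reflexive (≡.sym (ℕ.+-suc ∣ p ─ q ∣ ∣ q ∣)))

∣p∣≤∣p-x∣+1 : ∀ (p : Subset n) x → ∣ p ∣ ≤ ∣ p - x ∣ + 1
∣p∣≤∣p-x∣+1 p x = subst (∣ p ∣ ≤_) (cong (∣ p - x ∣ +_) (∣⁅x⁆∣≡1 x)) (∣p∣≤∣p─q∣+∣q∣ p ⁅ x ⁆)

p⊆q⇒∣p∩q∣≡∣p∣ : ∀ {p q : Subset n} → p ⊆ q → ∣ p ∩ q ∣ ≡ ∣ p ∣
p⊆q⇒∣p∩q∣≡∣p∣ {p = p} {q} p⊆q =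
  ℕ.≤-antisym (∣p∩q∣≤∣p∣ p q) (p⊆q⇒∣p∣≤∣q∣ (λ x∈p → x∈p∩q⁺ (x∈p , p⊆q x∈p)))

1≤∣p∣⇒Nonempty : ∀ (p : Subset n) → 1 ≤ ∣ p ∣ → Nonempty p
1≤∣p∣⇒Nonempty {n} p 1≤∣p∣ with nonempty? p
... | yes p≢∅ = p≢∅
... | no  p≡∅ = ⊥-elim (ℕ.<⇒≢ 1≤∣p∣ (≡.sym (≡.trans (cong ∣_∣ (Empty-unique p≡∅)) (∣⊥∣≡0 n))))

⊆-or-∃∉ : ∀ (p q : Subset n) → p ⊆ q ⊎ ∃ λ x → x ∈ p × x ∉ q
⊆-or-∃∉ p q with any? (λ x → (x ∈? p) ×-dec ¬? (x ∈? q))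
... | yes witness = inj₂ witness
... | no  none    = inj₁ p⊆q
  where
  p⊆q : p ⊆ q
  p⊆q {x} x∈p with x ∈? q
  ... | yes x∈q = x∈q
  ... | no  x∉q = ⊥-elim (none (x , x∈p , x∉q))

∈-tabulate⁻ : ∀ (f : Fin n → Bool) → x ∈ tabulate f → f x ≡ true
∈-tabulate⁻ {x = x} f x∈ = ≡.trans (≡.sym (lookup∘tabulate f x)) ([]=⇒lookup x∈)

∈-tabulate⁺ : ∀ (f : Fin n → Bool) → f x ≡ true → x ∈ tabulate f
∈-tabulate⁺ {x = x} f fx≡true = lookup⇒[]= x _ (≡.trans (lookup∘tabulate f x) fx≡true)

∈Class⇒≡ : ∀ {b} (c : Fin n → Fin b) i → x ∈ Class c i → c x ≡ i
∈Class⇒≡ {x = x} c i x∈ =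
  toWitness {a? = c x ≟ i} (Equivalence.from T-≡ (∈-tabulate⁻ (λ v → ⌊ c v ≟ i ⌋) x∈))

module _ (G : Graph n) where

  ∈N-sym : ∀ {u v} → u ∈ N G v → v ∈ N G u
  ∈N-sym {u} {v} u∈Nv =
    ∈-tabulate⁺ (adj G u) (≡.trans (Graph.sym G u v) (∈-tabulate⁻ (adj G v) u∈Nv))

  SameType⇒∈N : ∀ {u v w} → SameType G u v → w ∈ N G u → w ≢ v → w ∈ N G v
  SameType⇒∈N {u} {v} {w} same w∈Nu w≢v =
    p─q⊆p (N G v) ⁅ u ⁆ (subst (w ∈_) (≡.sym same) (x∈p∧x≢y⇒x∈p-y w∈Nu w≢v))

  module _ {C : Subset n} {u y : Fin n} (twins : ∀ {v} → v ∈ C → SameType G u v)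
           (y∈Nu : y ∈ N G u) where

    twins-y⊆N : C - y ⊆ N G y
    twins-y⊆N {v} v∈C-y = ∈N-sym (SameType⇒∈N (twins (p─q⊆p C ⁅ y ⁆ v∈C-y)) y∈Nu y≢v)
      where
      y≢v : y ≢ v
      y≢v refl = x∈p─q⇒x∉q C ⁅ y ⁆ v∈C-y (x∈⁅x⁆ y)

    ∣twins∩D∣≤∣Ny∩D∣+1 : ∀ D → ∣ C ∩ D ∣ ≤ ∣ N G y ∩ D ∣ + 1
    ∣twins∩D∣≤∣Ny∩D∣+1 D = ℕ.≤-trans (∣p∣≤∣p-x∣+1 (C ∩ D) y)
                                      (ℕ.+-monoˡ-≤ 1 (p⊆q⇒∣p∣≤∣q∣ C∩D-y⊆Ny∩D))
      where
      C∩D-y⊆Ny∩D : (C ∩ D) - y ⊆ N G y ∩ D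
      C∩D-y⊆Ny∩D {v} v∈ with x∈p∩q⁻ C D (p─q⊆p (C ∩ D) ⁅ y ⁆ v∈)
      ... | v∈C , v∈D =
        x∈p∩q⁺ (twins-y⊆N (x∈p∧x∉q⇒x∈p─q v∈C (x∈p─q⇒x∉q (C ∩ D) ⁅ y ⁆ v∈)) , v∈D)

lemma8 : (s : ℕ) (σ : ℕ → Set) → (∀ k → σ k → k ≤ s) →
    ∀ {n b} (G : Graph n) → Connected G →
    (c : Fin n → Fin b) → IsTypePartition G c →
    (D : Subset n) → IsSigmaRhoDom G σ Positive D →
    ∀ (i : Fin b) → ∣ Class c i ∩ D ∣ ≤ s + 1 ⊎ ∣ Class c i ∩ D ∣ ≡ ∣ Class c i ∣
lemma8 s σ σ≤s G _ c typePartition D (σ-in , ρ-out) i with ⊆-or-∃∉ (Class c i) D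
... | inj₁ Cᵢ⊆D = inj₂ (p⊆q⇒∣p∩q∣≡∣p∣ Cᵢ⊆D)
... | inj₂ (x , x∈Cᵢ , x∉D) with 1≤∣p∣⇒Nonempty (N G x ∩ D) (ρ-out x x∉D)
... | y , y∈Nx∩D with x∈p∩q⁻ (N G x) D y∈Nx∩D
... | y∈Nx , y∈D =
  inj₁ (ℕ.≤-trans (∣twins∩D∣≤∣Ny∩D∣+1 G twins y∈Nx D)
                  (ℕ.+-monoˡ-≤ 1 (σ≤s _ (σ-in y y∈D))))
  where
  twins : ∀ {v} → v ∈ Class c i → SameType G x v
  twins {v} v∈Cᵢ = typePartition x v
    (≡.trans (∈Class⇒≡ c i x∈Cᵢ) (≡.sym (∈Class⇒≡ c i v∈Cᵢ)))
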